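{- Let $H$ be an intersecting $3$-graph with $n=|V(H)|\ge 6$. If $\tau(H)\le 2$, then $H$ is contained in one of $H(n),H_0(n),\ldots,H_5(n)$. Consequently, (a) if $|H|\ge 11$, then $H$ is contained in one of $H(n),H_0(n),\ldots,H_5(n)$; (b) if $|H|>n+4$, then $H$ is contained in $H(n)$, $H_0(n)$, $H_1(n)$ or $H_2(n)$.
   Context: A $3$-graph is a family of $3$-element subsets (edges) of a finite vertex set $V(H)$; it is intersecting if every two edges intersect; $\tau(H)$ is the minimum size of a vertex set meeting every edge. "$H$ is contained in $K$" for a construction $K$ on $n$ vertices means the special vertices of $K$ can be chosen among $V(H)$ so that every edge of $H$ is an edge of $K$. All constructions below are on an $n$-element vertex set ($n\ge 6$): $H(n)$: a full star, i.e. all triples containing a fixed vertex. $H_0(n)$: special vertices $x,x_1,x_2$; all triples containing at least two of them. $H_1(n)$: special vertices $x,x_1,x_2,y_1$; all triples containing $\{x,x_1\}$ or $\{x,x_2\}$ or $\{x,y_1\}$, plus the triple $\{x_1,x_2,y_1\}$. $H_2(n)$: special vertices $x,x_1,x_2,y_1,y_2$; all triples containing $\{x,x_1\}$ or $\{x,x_2\}$, plus the triples $\{x_1,x_2,y_1\}$, $\{x_1,x_2,y_2\}$, $\{x,y_1,y_2\}$. $H_3(n)$: special vertices $v_1,v_2,y_1,y_2,y_3$; the $n-2$ triples containing $\{v_1,v_2\}$ and the $6$ triples consisting of one of $v_1,v_2$ and two of $y_1,y_2,y_3$. $H_4(n)$ and $H_5(n)$: special vertices $v_1,v_2,a,a',b,b'$;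 both contain all triples containing $\{v_1,v_2\}$. In addition $H_4(n)$ contains $v_1aa', v_1bb', v_2ab, v_2ab', v_2a'b, v_2a'b'$, and $H_5(n)$ contains $v_1aa', v_1bb', v_1ab', v_2ab', v_2ab, v_2a'b'$. -}

module Defs where

open import Data.Nat using (ℕ)
open import Data.Fin using (Fin)
open import Data.Fin.Subset using (Subset; _∈_; _∩_; _∪_; ⁅_⁆; ∣_∣; Nonempty)
open import Data.List using (List; _∷_; [])
open import Data.List.Relation.Unary.All using (All)
open import Data.List.Relation.Unary.Unique.Propositional using (Unique)
import Data.List.Membership.Propositional as L
open import Data.Product using (Σ; ∃; _×_)
open import Data.Sum using (_⊎_)
open import Relation.Binary.PropositionalEquality using (_≡_)
open import Data.Nat using (_≤_)

record ThreeGraph (n : ℕ) : Set where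
  field
    edges   : List (Subset n)
    unique  : Unique edges
    uniform : All (λ e → ∣ e ∣ ≡ 3) edges
open ThreeGraph public

size : ∀ {n} → ThreeGraph n → ℕ
size H = Data.List.length (edges H)

Intersecting : ∀ {n} → ThreeGraph n → Set
Intersecting H = ∀ {e f} → e L.∈ edges H → f L.∈ edges H → Nonempty (e ∩ f)

Cover : ∀ {n} → ThreeGraph n → Subset n → Set
Cover H T = All (λ e → Nonempty (e ∩ T)) (edges H)

τ≤ : ∀ {n} → ThreeGraph n → ℕ → Set
τ≤ {n} H k = Σ (Subset n) λ T → Cover H T × ∣ T ∣ ≤ k

triple : ∀ {n} → Fin n → Fin n → Fin n → Subset n
triple a b c = ⁅ a ⁆ ∪ (⁅ b ⁆ ∪ ⁅ c ⁆)

_,_⊆ₑ_ : ∀ {n} → Fin n → Fin n → Subset n → Set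
a , b ⊆ₑ e = (a ∈ e) × (b ∈ e)

EdgeH : ∀ {n} → Fin n → Subset n → Set
EdgeH x e = x ∈ e

EdgeH0 : ∀ {n} → Fin n → Fin n → Fin n → Subset n → Set
EdgeH0 x x₁ x₂ e = (x , x₁ ⊆ₑ e) ⊎ (x , x₂ ⊆ₑ e) ⊎ (x₁ , x₂ ⊆ₑ e)

EdgeH1 : ∀ {n} → Fin n → Fin n → Fin n → Fin n → Subset n → Set
EdgeH1 x x₁ x₂ y₁ e =
  (x , x₁ ⊆ₑ e) ⊎ (x , x₂ ⊆ₑ e) ⊎ (x , y₁ ⊆ₑ e) ⊎ (e ≡ triple x₁ x₂ y₁)

EdgeH2 : ∀ {n} → Fin n → Fin n → Fin n → Fin n → Fin n → Subset n → Set
EdgeH2 x x₁ x₂ y₁ y₂ e =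
  (x , x₁ ⊆ₑ e) ⊎ (x , x₂ ⊆ₑ e) ⊎ (e ≡ triple x₁ x₂ y₁) ⊎ (e ≡ triple x₁ x₂ y₂)
  ⊎ (e ≡ triple x y₁ y₂)

EdgeH3 : ∀ {n} → Fin n → Fin n → Fin n → Fin n → Fin n → Subset n → Set
EdgeH3 v₁ v₂ y₁ y₂ y₃ e =
  (v₁ , v₂ ⊆ₑ e)
  ⊎ (e ≡ triple v₁ y₁ y₂) ⊎ (e ≡ triple v₁ y₁ y₃) ⊎ (e ≡ triple v₁ y₂ y₃)
  ⊎ (e ≡ triple v₂ y₁ y₂) ⊎ (e ≡ triple v₂ y₁ y₃) ⊎ (e ≡ triple v₂ y₂ y₃)

EdgeH4 : ∀ {n} → Fin n → Fin n → Fin n → Fin n → Fin n → Fin n → Subset n → Set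
EdgeH4 v₁ v₂ a a' b b' e =
  (v₁ , v₂ ⊆ₑ e)
  ⊎ (e ≡ triple v₁ a a') ⊎ (e ≡ triple v₁ b b')
  ⊎ (e ≡ triple v₂ a b) ⊎ (e ≡ triple v₂ a b') ⊎ (e ≡ triple v₂ a' b) ⊎ (e ≡ triple v₂ a' b')

EdgeH5 : ∀ {n} → Fin n → Fin n → Fin n → Fin n → Fin n → Fin n → Subset n → Set
EdgeH5 v₁ v₂ a a' b b' e =
  (v₁ , v₂ ⊆ₑ e)
  ⊎ (e ≡ triple v₁ a a') ⊎ (e ≡ triple v₁ b b') ⊎ (e ≡ triple v₁ a b')
  ⊎ (e ≡ triple v₂ a b') ⊎ (e ≡ triple v₂ a b) ⊎ (e ≡ triple v₂ a' b')

InH : ∀ {n} → ThreeGraph n → Set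
InH {n} H = Σ (Fin n) λ x → All (EdgeH x) (edges H)

InH0 : ∀ {n} → ThreeGraph n → Set
InH0 {n} H = ∃ λ (x : Fin n) → ∃ λ x₁ → ∃ λ x₂ →
  Unique (x ∷ x₁ ∷ x₂ ∷ []) × All (EdgeH0 x x₁ x₂) (edges H)

InH1 : ∀ {n} → ThreeGraph n → Set
InH1 {n} H = ∃ λ (x : Fin n) → ∃ λ x₁ → ∃ λ x₂ → ∃ λ y₁ →
  Unique (x ∷ x₁ ∷ x₂ ∷ y₁ ∷ []) × All (EdgeH1 x x₁ x₂ y₁) (edges H)

InH2 : ∀ {n} → ThreeGraph n → Set
InH2 {n} H = ∃ λ (x : Fin n) → ∃ λ x₁ → ∃ λ x₂ → ∃ λ y₁ → ∃ λ y₂ →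
  Unique (x ∷ x₁ ∷ x₂ ∷ y₁ ∷ y₂ ∷ []) × All (EdgeH2 x x₁ x₂ y₁ y₂) (edges H)

InH3 : ∀ {n} → ThreeGraph n → Set
InH3 {n} H = ∃ λ (v₁ : Fin n) → ∃ λ v₂ → ∃ λ y₁ → ∃ λ y₂ → ∃ λ y₃ →
  Unique (v₁ ∷ v₂ ∷ y₁ ∷ y₂ ∷ y₃ ∷ []) × All (EdgeH3 v₁ v₂ y₁ y₂ y₃) (edges H)

InH4 : ∀ {n} → ThreeGraph n → Set
InH4 {n} H = ∃ λ (v₁ : Fin n) → ∃ λ v₂ → ∃ λ a → ∃ λ a' → ∃ λ b → ∃ λ b' →
  Unique (v₁ ∷ v₂ ∷ a ∷ a' ∷ b ∷ b' ∷ []) × All (EdgeH4 v₁ v₂ a a' b b') (edges H)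

InH5 : ∀ {n} → ThreeGraph n → Set
InH5 {n} H = ∃ λ (v₁ : Fin n) → ∃ λ v₂ → ∃ λ a → ∃ λ a' → ∃ λ b → ∃ λ b' →
  Unique (v₁ ∷ v₂ ∷ a ∷ a' ∷ b ∷ b' ∷ []) × All (EdgeH5 v₁ v₂ a a' b b') (edges H)

InSomeH0to2 : ∀ {n} → ThreeGraph n → Set
InSomeH0to2 H = InH H ⊎ InH0 H ⊎ InH1 H ⊎ InH2 H

InSomeH0to5 : ∀ {n} → ThreeGraph n → Set
InSomeH0to5 H = InSomeH0to2 H ⊎ InH3 H ⊎ InH4 H ⊎ InH5 H

module Submission where

-- The theorem is a finite, but very large, case analysis on intersecting
-- 3-graphs.  Rather than writing the cases out, this file proves a checker for
-- case-analysis certificates sound and runs it on certificates found by search.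
--
-- The checker explores H through a duplicate-free list s of vertices.  An edge e
-- is seen only through its signature, the bit vector recording which vertices
-- of s lie in e; H is abstracted by a list A of candidate signatures containing
-- the signature of every edge.  A certificate splits on a candidate (either no
-- edge has it and it is dropped, or some edge e has it: then either e lies
-- inside s and, H being intersecting, only candidates meeting e survive, or the
-- unexplored vertices of e are added to s), adds arbitrary fresh vertices
-- (n ≥ 6 guarantees they exist), and ends in leaves from which one reads off that
-- H lies in one of H, H₀, …, H₅, or that H has at most 10 edges, or that
-- τ(H) ≤ 2.
--
-- The τ ≤ 2 part starts the
-- exploration from a cover; part (a) starts from nothing and, when H has more
-- than 10 edges and τ(H) ≤ 2, falls back on the τ ≤ 2 part; part (b) follows
-- from (a) because H₃, H₄, H₅ have at most n + 4 edges.

open import Defs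
open import Data.Bool using (Bool; true; false; _∧_; _∨_; if_then_else_; T)
open import Data.Bool.Properties using (T-∧; T-∨; T?) renaming (_≟_ to _≟ᵇ_)
open import Data.Empty using (⊥-elim)
open import Data.Fin using (Fin)
import Data.Fin as Fin
open import Data.Fin.Properties using (suc-injective) renaming (_≟_ to _≟ᶠ_)
open import Data.Fin.Subset using (Subset; _∈_; _∩_; _∪_; ⁅_⁆; ∣_∣; Nonempty; inside; outside)
open import Data.Fin.Subset.Properties
  using (_∈?_; x∈p∪q⁻; x∈p∪q⁺; x∈p∩q⁻; x∈p∩q⁺; x∈⁅y⁆⇒x≡y; x∈⁅x⁆; ∣⁅x⁆∣≡1; ⊆-antisym)
open import Data.Bool.ListAction using (all)
open import Data.List using (List; []; _∷_; length; map; _++_; allFin; filter; filterᵇ)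
open import Data.List.Properties
  using (length-map; length-++; length-tabulate; ≡-dec; ∷-injectiveˡ; ∷-injectiveʳ)
open import Data.List.Membership.Propositional using (find; lose) renaming (_∈_ to _∈ₗ_; _∉_ to _∉ₗ_)
open import Data.List.Membership.Propositional.Properties
  using (∈-map⁺; ∈-map⁻; ∈-filter⁺; ∈-filter⁻; ∈-++⁺ˡ; ∈-++⁺ʳ; ∈-allFin)
open import Data.List.Relation.Binary.Pointwise using (Pointwise; []; _∷_)
open import Data.List.Relation.Unary.All using (All; []; _∷_; all?)
import Data.List.Relation.Unary.All as All
open import Data.List.Relation.Unary.All.Properties using (¬All⇒Any¬; ¬Any⇒All¬; all⁺; map⁺)
open import Data.List.Relation.Unary.Any using (here; there; any?; satisfied)
open import Data.List.Relation.Unary.AllPairs using ([]; _∷_)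
open import Data.List.Relation.Unary.Unique.Propositional using (Unique)
open import Data.List.Relation.Unary.Unique.Propositional.Properties
  using (allFin⁺; filter⁺) renaming (map⁺ to unique-map⁺)
open import Data.Maybe using (Maybe; just; nothing)
open import Data.Nat using (ℕ; zero; suc; _+_; _≤_; _<_; z≤n; s≤s; _<ᵇ_; _≤ᵇ_; _≡ᵇ_) renaming (_≟_ to _≟ℕ_)
open import Data.Nat.Properties
  using (≤-trans; ≤-reflexive; <-≤-trans; <⇒≱; ≰⇒>; +-suc; +-comm; +-monoʳ-≤; +-monoˡ-≤; n≤1+n; ≤-pred;
         <ᵇ⇒<; <⇒<ᵇ; ≤ᵇ⇒≤; ≤⇒≤ᵇ; ≡ᵇ⇒≡)
open import Data.List.Relation.Unary.Unique.DecPropositional _≟ℕ_ using (unique?)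
open import Data.Product using (∃; _×_; _,_; proj₁; proj₂)
open import Data.Sum using (_⊎_; inj₁; inj₂)
import Data.Sum as Sum
open import Data.Unit using (tt)
open import Data.Vec using ([]; _∷_; here; there)
open import Function using (_∘_)
open import Function.Bundles using (Equivalence)
open import Relation.Binary.PropositionalEquality
  using (_≡_; _≢_; refl; sym; trans; cong; cong₂; subst; module ≡-Reasoning)
open import Relation.Nullary using (Dec; yes; no; isYes; ¬?)
open import Relation.Nullary.Decidable using (toWitness; fromWitness)

module _ {A : Set} where

  remove : {x : A} (ys : List A) → x ∈ₗ ys → List A
  remove (_ ∷ ys) (here _)  = ys
  remove (y ∷ ys) (there p) = y ∷ remove ys p

  length-remove : {x : A} (ys : List A) (p : x ∈ₗ ys) → suc (length (remove ys p)) ≡ length ys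
  length-remove (_ ∷ _)  (here _)  = refl
  length-remove (_ ∷ ys) (there p) = cong suc (length-remove ys p)

  ∈-remove : {x z : A} (ys : List A) (p : x ∈ₗ ys) → z ∈ₗ ys → z ≢ x → z ∈ₗ remove ys p
  ∈-remove (_ ∷ _)  (here refl) (here refl) z≢x = ⊥-elim (z≢x refl)
  ∈-remove (_ ∷ _)  (here _)    (there q)   _   = q
  ∈-remove (_ ∷ _)  (there _)   (here z≡y)  _   = here z≡y
  ∈-remove (_ ∷ ys) (there p)   (there q)   z≢x = there (∈-remove ys p q z≢x)

  unique-length-≤ : (xs ys : List A) → Unique xs → All (_∈ₗ ys) xs → length xs ≤ length ys
  unique-length-≤ []       ys _              _               = z≤n
  unique-length-≤ (x ∷ xs) ys (x∉xs ∷ xs-un) (x∈ys ∷ xs⊆ys) =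
    subst (suc (length xs) ≤_) (length-remove ys x∈ys)
      (s≤s (unique-length-≤ xs (remove ys x∈ys) xs-un (All.tabulate kept)))
    where
    kept : ∀ {z} → z ∈ₗ xs → z ∈ₗ remove ys x∈ys
    kept z∈xs = ∈-remove ys x∈ys (All.lookup xs⊆ys z∈xs) (λ z≡x → All.lookup x∉xs z∈xs (sym z≡x))

  map-unique : {B : Set} (f : A → B) (xs : List A) → Unique xs →
               (∀ {x y} → x ∈ₗ xs → y ∈ₗ xs → f x ≡ f y → x ≡ y) → Unique (map f xs)
  map-unique f []       _              _   = []
  map-unique f (x ∷ xs) (x∉xs ∷ xs-un) inj =
    map⁺ (All.tabulate λ y∈xs fx≡fy → All.lookup x∉xs y∈xs (inj (here refl) (there y∈xs) fx≡fy))
    ∷ map-unique f xs xs-un (λ x∈xs y∈xs → inj (there x∈xs) (there y∈xs))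

  -- The i-th entry of a list, if any; certificates refer to vertices and
  -- candidates by their positions.
  position : List A → ℕ → Maybe A
  position []       _       = nothing
  position (x ∷ _)  zero    = just x
  position (_ ∷ xs) (suc i) = position xs i

  At : List A → ℕ → A → Set
  At xs i x = position xs i ≡ just x

  at-∈ : ∀ xs i {x} → At xs i x → x ∈ₗ xs
  at-∈ (_ ∷ _)  zero    refl = here refl
  at-∈ (_ ∷ xs) (suc i) p    = there (at-∈ xs i p)

  at-exists : ∀ xs i → i < length xs → ∃ λ x → At xs i x
  at-exists (x ∷ _)  zero    _       = x , refl
  at-exists (_ ∷ xs) (suc i) (s≤s p) = at-exists xs i p

  at-injective : ∀ xs → Unique xs → ∀ i j {x y} → At xs i x → At xs j y → i ≢ j → x ≢ y
  at-injective (_ ∷ _)  _           zero    zero    _    _    i≢j _    = i≢j refl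
  at-injective (_ ∷ xs) (x∉xs ∷ _)  zero    (suc j) refl q    _   refl = All.lookup x∉xs (at-∈ xs j q) refl
  at-injective (_ ∷ xs) (x∉xs ∷ _)  (suc i) zero    p    refl _   refl = All.lookup x∉xs (at-∈ xs i p) refl
  at-injective (_ ∷ xs) (_ ∷ xs-un) (suc i) (suc j) p    q    i≢j    =
    at-injective xs xs-un i j p q (i≢j ∘ cong suc)

  entries : ∀ xs is → All (_< length xs) is → ∃ λ ys → Pointwise (At xs) is ys
  entries xs []       []         = [] , []
  entries xs (i ∷ is) (i< ∷ is<) with at-exists xs i i< | entries xs is is<
  ... | y , p | ys , ps = y ∷ ys , p ∷ ps

  entries-unique : ∀ xs → Unique xs → ∀ {is ys} → Unique is → Pointwise (At xs) is ys → Unique ys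
  entries-unique xs xs-un []             []       = []
  entries-unique xs xs-un (i∉is ∷ is-un) (p ∷ ps) = apart p i∉is ps ∷ entries-unique xs xs-un is-un ps
    where
    apart : ∀ {i y js zs} → At xs i y → All (i ≢_) js → Pointwise (At xs) js zs → All (y ≢_) zs
    apart p []          []       = []
    apart p (i≢j ∷ i≢js) (q ∷ qs) = at-injective xs xs-un _ _ p q i≢j ∷ apart p i≢js qs

_∈ₗ?_ : ∀ {n} (x : Fin n) (xs : List (Fin n)) → Dec (x ∈ₗ xs)
x ∈ₗ? xs = any? (x ≟ᶠ_) xs

unlisted : ∀ {n} (xs : List (Fin n)) → length xs < n → ∃ λ x → x ∉ₗ xs
unlisted {n} xs xs<n with all? (_∈ₗ? xs) (allFin n)
... | yes all∈xs = ⊥-elim (<⇒≱ xs<n (subst (_≤ length xs) (length-tabulate (λ x → x))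
                     (unique-length-≤ (allFin n) xs (allFin⁺ n) all∈xs)))
... | no ¬all∈xs = satisfied (¬All⇒Any¬ (_∈ₗ? xs) (allFin n) ¬all∈xs)

record Enumeration {n} (p : Subset n) : Set where
  field
    members  : List (Fin n)
    distinct : Unique members
    size≡    : length members ≡ ∣ p ∣
    complete : ∀ {x} → x ∈ p → x ∈ₗ members
    sound    : ∀ {x} → x ∈ₗ members → x ∈ p

module Shift {n} {p : Subset n} (E : Enumeration p) where
  open Enumeration E

  shifted : List (Fin (suc n))
  shifted = map Fin.suc members

  shifted-distinct : Unique shifted
  shifted-distinct = unique-map⁺ suc-injective distinct

  shifted-size : length shifted ≡ ∣ p ∣
  shifted-size = trans (length-map Fin.suc members) size≡

  zero∉shifted : All (Fin.zero ≢_) shifted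
  zero∉shifted = All.tabulate zero≢
    where
    zero≢ : ∀ {x} → x ∈ₗ shifted → Fin.zero ≢ x
    zero≢ x∈shifted with ∈-map⁻ Fin.suc x∈shifted
    ... | _ , _ , refl = λ ()

  shifted-complete : ∀ {x} → x ∈ p → Fin.suc x ∈ₗ shifted
  shifted-complete x∈p = ∈-map⁺ Fin.suc (complete x∈p)

  shifted-sound : ∀ {b x} → x ∈ₗ shifted → x ∈ (b ∷ p)
  shifted-sound x∈shifted with ∈-map⁻ Fin.suc x∈shifted
  ... | _ , y∈members , refl = there (sound y∈members)

enumerate : ∀ {n} (p : Subset n) → Enumeration p
enumerate [] = record { members = [] ; distinct = [] ; size≡ = refl ; complete = λ () ; sound = λ () }
enumerate (inside ∷ p) = record
  { members  = Fin.zero ∷ shifted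
  ; distinct = zero∉shifted ∷ shifted-distinct
  ; size≡    = cong suc shifted-size
  ; complete = complete₀
  ; sound    = sound₀
  }
  where
  open Shift (enumerate p)
  complete₀ : ∀ {x} → x ∈ (inside ∷ p) → x ∈ₗ Fin.zero ∷ shifted
  complete₀ here        = here refl
  complete₀ (there x∈p) = there (shifted-complete x∈p)
  sound₀ : ∀ {x} → x ∈ₗ Fin.zero ∷ shifted → x ∈ (inside ∷ p)
  sound₀ (here refl)       = here
  sound₀ (there x∈shifted) = shifted-sound x∈shifted
enumerate (outside ∷ p) = record
  { members  = shifted
  ; distinct = shifted-distinct
  ; size≡    = shifted-size
  ; complete = complete₀
  ; sound    = shifted-sound
  }
  where
  open Shift (enumerate p)
  complete₀ : ∀ {x} → x ∈ (outside ∷ p) → x ∈ₗ shifted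
  complete₀ (there x∈p) = shifted-complete x∈p

members-bound : ∀ {n} {p : Subset n} (xs : List (Fin n)) → Unique xs → All (_∈ p) xs → length xs ≤ ∣ p ∣
members-bound {p = p} xs xs-un xs⊆p =
  subst (length xs ≤_) size≡ (unique-length-≤ xs members xs-un (All.map complete xs⊆p))
  where open Enumeration (enumerate p)

members-saturate : ∀ {n} {p : Subset n} (xs : List (Fin n)) → Unique xs → All (_∈ p) xs →
                   ∣ p ∣ ≤ length xs → ∀ {x} → x ∈ p → x ∈ₗ xs
members-saturate xs xs-un xs⊆p p≤xs {x} x∈p with x ∈ₗ? xs
... | yes x∈xs = x∈xs
... | no  x∉xs = ⊥-elim (<⇒≱ (members-bound (x ∷ xs) (¬Any⇒All¬ xs x∉xs ∷ xs-un) (x∈p ∷ xs⊆p)) p≤xs)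

member-outside : ∀ {n} (p : Subset n) (xs : List (Fin n)) → length xs < ∣ p ∣ → ∃ λ x → x ∈ p × x ∉ₗ xs
member-outside p xs xs<p = missing (all? (_∈ₗ? xs) members)
  where
  open Enumeration (enumerate p)
  missing : Dec (All (_∈ₗ xs) members) → ∃ λ x → x ∈ p × x ∉ₗ xs
  missing (yes members⊆xs) =
    ⊥-elim (<⇒≱ xs<p (subst (_≤ length xs) size≡ (unique-length-≤ members xs distinct members⊆xs)))
  missing (no ¬members⊆xs) with find (¬All⇒Any¬ (_∈ₗ? xs) members ¬members⊆xs)
  ... | x , x∈members , x∉xs = x , sound x∈members , x∉xs

∈triple⁻ : ∀ {n} {a b c x : Fin n} → x ∈ triple a b c → x ∈ₗ a ∷ b ∷ c ∷ []
∈triple⁻ {a = a} {b} {c} x∈abc with x∈p∪q⁻ ⁅ a ⁆ (⁅ b ⁆ ∪ ⁅ c ⁆) x∈abc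
... | inj₁ x∈a = here (x∈⁅y⁆⇒x≡y a x∈a)
... | inj₂ x∈bc with x∈p∪q⁻ ⁅ b ⁆ ⁅ c ⁆ x∈bc
...   | inj₁ x∈b = there (here (x∈⁅y⁆⇒x≡y b x∈b))
...   | inj₂ x∈c = there (there (here (x∈⁅y⁆⇒x≡y c x∈c)))

∈triple⁺ : ∀ {n} {a b c x : Fin n} → x ∈ₗ a ∷ b ∷ c ∷ [] → x ∈ triple a b c
∈triple⁺ (here refl)                 = x∈p∪q⁺ (inj₁ (x∈⁅x⁆ _))
∈triple⁺ (there (here refl))         = x∈p∪q⁺ (inj₂ (x∈p∪q⁺ (inj₁ (x∈⁅x⁆ _))))
∈triple⁺ (there (there (here refl))) = x∈p∪q⁺ (inj₂ (x∈p∪q⁺ (inj₂ (x∈⁅x⁆ _))))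

≡triple : ∀ {n} {e : Subset n} {x y z} → ∣ e ∣ ≡ 3 → x ∈ e → y ∈ e → z ∈ e →
          x ≢ y → x ≢ z → y ≢ z → e ≡ triple x y z
≡triple {e = e} {x} {y} {z} e≡3 x∈e y∈e z∈e x≢y x≢z y≢z =
  ⊆-antisym (λ w∈e → ∈triple⁺ (members-saturate (x ∷ y ∷ z ∷ []) xyz-distinct xyz⊆e (≤-reflexive e≡3) w∈e))
            (λ w∈xyz → All.lookup xyz⊆e (∈triple⁻ w∈xyz))
  where
  xyz-distinct : Unique (x ∷ y ∷ z ∷ [])
  xyz-distinct = (x≢y ∷ x≢z ∷ []) ∷ (y≢z ∷ []) ∷ [] ∷ []
  xyz⊆e : All (_∈ e) (x ∷ y ∷ z ∷ [])
  xyz⊆e = x∈e ∷ y∈e ∷ z∈e ∷ []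

∣p∪q∣≤∣p∣+∣q∣ : ∀ {n} (p q : Subset n) → ∣ p ∪ q ∣ ≤ ∣ p ∣ + ∣ q ∣
∣p∪q∣≤∣p∣+∣q∣ []           []           = z≤n
∣p∪q∣≤∣p∣+∣q∣ (inside ∷ p)  (inside ∷ q)  = s≤s (≤-trans (∣p∪q∣≤∣p∣+∣q∣ p q) (+-monoʳ-≤ ∣ p ∣ (n≤1+n ∣ q ∣)))
∣p∪q∣≤∣p∣+∣q∣ (inside ∷ p)  (outside ∷ q) = s≤s (∣p∪q∣≤∣p∣+∣q∣ p q)
∣p∪q∣≤∣p∣+∣q∣ (outside ∷ p) (inside ∷ q)  =
  ≤-trans (s≤s (∣p∪q∣≤∣p∣+∣q∣ p q)) (≤-reflexive (sym (+-suc ∣ p ∣ ∣ q ∣)))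
∣p∪q∣≤∣p∣+∣q∣ (outside ∷ p) (outside ∷ q) = ∣p∪q∣≤∣p∣+∣q∣ p q

-- The trace of an edge on the list of explored vertices, as a bit vector.
Signature : Set
Signature = List Bool

ones : Signature → ℕ
ones []          = 0
ones (true ∷ σ)  = suc (ones σ)
ones (false ∷ σ) = ones σ

-- The i-th bit, false beyond the end.
bit : Signature → ℕ → Bool
bit []      _       = false
bit (b ∷ _) zero    = b
bit (_ ∷ σ) (suc i) = bit σ i

meets : Signature → Signature → Bool
meets (true ∷ _) (true ∷ _) = true
meets (_ ∷ σ)    (_ ∷ τ)    = meets σ τ
meets _          _          = false

meets-later : ∀ a b σ τ → T (meets σ τ) → T (meets (a ∷ σ) (b ∷ τ))
meets-later true  true  σ τ _ = tt
meets-later true  false σ τ h = h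
meets-later false true  σ τ h = h
meets-later false false σ τ h = h

signature : ∀ {n} → List (Fin n) → Subset n → Signature
signature s e = map (λ x → isYes (x ∈? e)) s

explored : ∀ {n} → Subset n → List (Fin n) → List (Fin n)
explored e = filter (_∈? e)

ones-signature : ∀ {n} (e : Subset n) s → ones (signature s e) ≡ length (explored e s)
ones-signature e []      = refl
ones-signature e (x ∷ s) with x ∈? e
... | yes _ = cong suc (ones-signature e s)
... | no  _ = ones-signature e s

explored-distinct : ∀ {n} (e : Subset n) s → Unique s → Unique (explored e s)
explored-distinct e s = filter⁺ (_∈? e)

explored⊆ : ∀ {n} (e : Subset n) s → All (_∈ e) (explored e s)
explored⊆ e s = All.tabulate (proj₂ ∘ ∈-filter⁻ (_∈? e) {xs = s})

ones-bound : ∀ {n} (e : Subset n) s → Unique s → ones (signature s e) ≤ ∣ e ∣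
ones-bound e s s-un = subst (_≤ ∣ e ∣) (sym (ones-signature e s))
  (members-bound (explored e s) (explored-distinct e s s-un) (explored⊆ e s))

unexplored-member : ∀ {n} (e : Subset n) s → ones (signature s e) < ∣ e ∣ → ∃ λ x → x ∈ e × x ∉ₗ s
unexplored-member e s few with member-outside e (explored e s) (subst (_< ∣ e ∣) (ones-signature e s) few)
... | x , x∈e , x∉explored = x , x∈e , λ x∈s → x∉explored (∈-filter⁺ (_∈? e) x∈s x∈e)

fully-explored : ∀ {n} (e : Subset n) s → Unique s → ∣ e ∣ ≤ ones (signature s e) → ∀ {x} → x ∈ e → x ∈ₗ s
fully-explored e s s-un full x∈e = proj₁ (∈-filter⁻ (_∈? e)
  (members-saturate (explored e s) (explored-distinct e s s-un) (explored⊆ e s)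
    (subst (∣ e ∣ ≤_) (ones-signature e s) full) x∈e))

ones-positive : ∀ {n} (s : List (Fin n)) {x e} → x ∈ₗ s → x ∈ e → 1 ≤ ones (signature s e)
ones-positive (x ∷ s) {e = e} (here refl) x∈e with x ∈? e
... | yes _   = s≤s z≤n
... | no  x∉e = ⊥-elim (x∉e x∈e)
ones-positive (y ∷ s) {e = e} (there x∈s) x∈e with y ∈? e
... | yes _ = s≤s z≤n
... | no  _ = ones-positive s x∈s x∈e

signature-member : ∀ {n} (s : List (Fin n)) {x e} → x ∈ e → signature (x ∷ s) e ≡ true ∷ signature s e
signature-member s {x} {e} x∈e with x ∈? e
... | yes _   = refl
... | no  x∉e = ⊥-elim (x∉e x∈e)

bit-sound : ∀ {n} (s : List (Fin n)) i {x e} → At s i x → T (bit (signature s e) i) → x ∈ e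
bit-sound (x ∷ s) zero    {e = e} refl b = toWitness {a? = x ∈? e} b
bit-sound (_ ∷ s) (suc i)         p    b = bit-sound s i p b

meets-complete : ∀ {n} (s : List (Fin n)) {x e f} → x ∈ₗ s → x ∈ e → x ∈ f →
                 T (meets (signature s e) (signature s f))
meets-complete (x ∷ s) {e = e} {f} (here refl) x∈e x∈f with x ∈? e | x ∈? f
... | yes _   | yes _   = tt
... | no  x∉e | _       = ⊥-elim (x∉e x∈e)
... | yes _   | no  x∉f = ⊥-elim (x∉f x∈f)
meets-complete (y ∷ s) {e = e} {f} (there x∈s) x∈e x∈f =
  meets-later (isYes (y ∈? e)) (isYes (y ∈? f)) _ _ (meets-complete s x∈s x∈e x∈f)

signature-agree : ∀ {n} (s : List (Fin n)) {x e f} → x ∈ₗ s → signature s e ≡ signature s f → x ∈ e → x ∈ f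
signature-agree (x ∷ s) {e = e} {f} (here refl) same x∈e =
  toWitness {a? = x ∈? f} (subst T (∷-injectiveˡ same) (fromWitness {a? = x ∈? e} x∈e))
signature-agree (_ ∷ s) (there x∈s) same = signature-agree s x∈s (∷-injectiveʳ same)

allSignatures : ℕ → List Signature
allSignatures zero    = [] ∷ []
allSignatures (suc k) = map (false ∷_) (allSignatures k) ++ map (true ∷_) (allSignatures k)

∈-allSignatures : ∀ (σ : Signature) → σ ∈ₗ allSignatures (length σ)
∈-allSignatures []          = here refl
∈-allSignatures (false ∷ σ) = ∈-++⁺ˡ (∈-map⁺ (false ∷_) (∈-allSignatures σ))
∈-allSignatures (true ∷ σ)  =
  ∈-++⁺ʳ (map (false ∷_) (allSignatures (length σ))) (∈-map⁺ (true ∷_) (∈-allSignatures σ))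

-- The certificate checker.

-- Exploring one more vertex: each candidate gains a new first bit, which may
-- be a one only while the candidate has fewer than three ones.
extend : List Signature → List Signature
extend []      = []
extend (σ ∷ A) = (false ∷ σ) ∷ (if ones σ <ᵇ 3 then (true ∷ σ) ∷ extend A else extend A)

∈-extend : ∀ {b σ} (A : List Signature) → σ ∈ₗ A → ones (b ∷ σ) ≤ 3 → (b ∷ σ) ∈ₗ extend A
∈-extend {false} (_ ∷ _) (here refl) _ = here refl
∈-extend {true}  (σ ∷ _) (here refl) room with ones σ <ᵇ 3 | <⇒<ᵇ room
... | true | _ = there (here refl)
∈-extend (τ ∷ A) (there σ∈A) room with ones τ <ᵇ 3
... | true  = there (there (∈-extend A σ∈A room))
... | false = there (∈-extend A σ∈A room)

_≟ˢ_ : (σ τ : Signature) → Dec (σ ≡ τ)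
_≟ˢ_ = ≡-dec _≟ᵇ_

without : Signature → List Signature → List Signature
without σ = filter (λ τ → ¬? (σ ≟ˢ τ))

meeting : Signature → List Signature → List Signature
meeting σ = filterᵇ (meets σ)

full : Signature → Bool
full σ = 3 ≤ᵇ ones σ

-- Initial candidates when the explored vertices form a cover.
coverCandidates : ℕ → List Signature
coverCandidates k = filterᵇ (λ σ → (1 ≤ᵇ ones σ) ∧ (ones σ ≤ᵇ 3)) (allSignatures k)

inRange : ℕ → List ℕ → Bool
inRange k = all (_<ᵇ k)

distinctInRange : ℕ → List ℕ → Bool
distinctInRange k is = inRange k is ∧ isYes (unique? is)

hasPair : Signature → ℕ → ℕ → Bool
hasPair σ i j = bit σ i ∧ bit σ j

hasTriple : Signature → ℕ → ℕ → ℕ → Bool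
hasTriple σ i j l = bit σ i ∧ bit σ j ∧ bit σ l

isEdgeH0 : ℕ → ℕ → ℕ → Signature → Bool
isEdgeH0 x x₁ x₂ σ = hasPair σ x x₁ ∨ hasPair σ x x₂ ∨ hasPair σ x₁ x₂

isEdgeH1 : ℕ → ℕ → ℕ → ℕ → Signature → Bool
isEdgeH1 x x₁ x₂ y₁ σ = hasPair σ x x₁ ∨ hasPair σ x x₂ ∨ hasPair σ x y₁ ∨ hasTriple σ x₁ x₂ y₁

isEdgeH2 : ℕ → ℕ → ℕ → ℕ → ℕ → Signature → Bool
isEdgeH2 x x₁ x₂ y₁ y₂ σ =
  hasPair σ x x₁ ∨ hasPair σ x x₂ ∨ hasTriple σ x₁ x₂ y₁ ∨ hasTriple σ x₁ x₂ y₂ ∨ hasTriple σ x y₁ y₂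

isEdgeH3 : ℕ → ℕ → ℕ → ℕ → ℕ → Signature → Bool
isEdgeH3 v₁ v₂ y₁ y₂ y₃ σ =
  hasPair σ v₁ v₂ ∨ hasTriple σ v₁ y₁ y₂ ∨ hasTriple σ v₁ y₁ y₃ ∨ hasTriple σ v₁ y₂ y₃
  ∨ hasTriple σ v₂ y₁ y₂ ∨ hasTriple σ v₂ y₁ y₃ ∨ hasTriple σ v₂ y₂ y₃

isEdgeH4 : ℕ → ℕ → ℕ → ℕ → ℕ → ℕ → Signature → Bool
isEdgeH4 v₁ v₂ a a' b b' σ =
  hasPair σ v₁ v₂ ∨ hasTriple σ v₁ a a' ∨ hasTriple σ v₁ b b'
  ∨ hasTriple σ v₂ a b ∨ hasTriple σ v₂ a b' ∨ hasTriple σ v₂ a' b ∨ hasTriple σ v₂ a' b'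

isEdgeH5 : ℕ → ℕ → ℕ → ℕ → ℕ → ℕ → Signature → Bool
isEdgeH5 v₁ v₂ a a' b b' σ =
  hasPair σ v₁ v₂ ∨ hasTriple σ v₁ a a' ∨ hasTriple σ v₁ b b' ∨ hasTriple σ v₁ a b'
  ∨ hasTriple σ v₂ a b' ∨ hasTriple σ v₂ a b ∨ hasTriple σ v₂ a' b'

-- A placement of one of the constructions: the positions, among the explored
-- vertices, of its special vertices (in the order of its definition).
data Placement : Set where
  inH  : ℕ → Placement
  inH0 : ℕ → ℕ → ℕ → Placement
  inH1 : ℕ → ℕ → ℕ → ℕ → Placement
  inH2 : ℕ → ℕ → ℕ → ℕ → ℕ → Placement
  inH3 : ℕ → ℕ → ℕ → ℕ → ℕ → Placement
  inH4 : ℕ → ℕ → ℕ → ℕ → ℕ → ℕ → Placement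
  inH5 : ℕ → ℕ → ℕ → ℕ → ℕ → ℕ → Placement

checkPlacement : ℕ → List Signature → Placement → Bool
checkPlacement k A (inH x) = inRange k (x ∷ []) ∧ all (λ σ → bit σ x) A
checkPlacement k A (inH0 x x₁ x₂) =
  distinctInRange k (x ∷ x₁ ∷ x₂ ∷ []) ∧ all (isEdgeH0 x x₁ x₂) A
checkPlacement k A (inH1 x x₁ x₂ y₁) =
  distinctInRange k (x ∷ x₁ ∷ x₂ ∷ y₁ ∷ []) ∧ all (isEdgeH1 x x₁ x₂ y₁) A
checkPlacement k A (inH2 x x₁ x₂ y₁ y₂) =
  distinctInRange k (x ∷ x₁ ∷ x₂ ∷ y₁ ∷ y₂ ∷ []) ∧ all (isEdgeH2 x x₁ x₂ y₁ y₂) A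
checkPlacement k A (inH3 v₁ v₂ y₁ y₂ y₃) =
  distinctInRange k (v₁ ∷ v₂ ∷ y₁ ∷ y₂ ∷ y₃ ∷ []) ∧ all (isEdgeH3 v₁ v₂ y₁ y₂ y₃) A
checkPlacement k A (inH4 v₁ v₂ a a' b b') =
  distinctInRange k (v₁ ∷ v₂ ∷ a ∷ a' ∷ b ∷ b' ∷ []) ∧ all (isEdgeH4 v₁ v₂ a a' b b') A
checkPlacement k A (inH5 v₁ v₂ a a' b b') =
  distinctInRange k (v₁ ∷ v₂ ∷ a ∷ a' ∷ b ∷ b' ∷ []) ∧ all (isEdgeH5 v₁ v₂ a a' b b') A

-- A certificate is a case analysis: 'split i' branches on whether some edge has
-- the i-th candidate signature, 'fresh' explores a new vertex, and the leaves
-- certify that H lies in a placed construction, has at most 10 edges, or is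
-- covered by two explored vertices.
data Certificate : Set where
  split     : ℕ → Certificate → Certificate → Certificate
  fresh     : Certificate → Certificate
  placed    : Placement → Certificate
  leafSmall : Certificate
  leafCover : ℕ → ℕ → Certificate

-- 'check exits k A c': the certificate c is valid with k explored vertices and
-- candidates A; the last two leaves are accepted only when 'exits' holds.  When
-- an edge with signature σ is present, 'checkPresent' explores its remaining
-- vertices (at most three, the fuel) until it is fully explored.
mutual
  check : Bool → ℕ → List Signature → Certificate → Bool
  check exits k A (split i c₁ c₂) = checkSplit exits k A (position A i) c₁ c₂
  check exits k A (fresh c) = (k <ᵇ 6) ∧ check exits (suc k) (extend A) c
  check exits k A (placed l) = checkPlacement k A l
  check exits k A leafSmall = exits ∧ all (λ σ → ones σ ≡ᵇ 3) A ∧ (length A ≤ᵇ 10)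
  check exits k A (leafCover i j) = exits ∧ inRange k (i ∷ j ∷ []) ∧ all (λ σ → bit σ i ∨ bit σ j) A

  checkSplit : Bool → ℕ → List Signature → Maybe Signature → Certificate → Certificate → Bool
  checkSplit exits k A nothing  c₁ c₂ = false
  checkSplit exits k A (just σ) c₁ c₂ = check exits k (without σ A) c₁ ∧ checkPresent exits 3 k A σ c₂

  checkPresent : Bool → ℕ → ℕ → List Signature → Signature → Certificate → Bool
  checkPresent exits zero       k A σ c = full σ ∧ check exits k (meeting σ A) c
  checkPresent exits (suc fuel) k A σ c =
    if full σ then check exits k (meeting σ A) c
    else checkPresent exits fuel (suc k) (extend A) (true ∷ σ) c

∧⁻ : ∀ a {b} → T (a ∧ b) → T a × T b
∧⁻ a = Equivalence.to (T-∧ {a})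

either : ∀ {a b} {P Q : Set} → (T a → P) → (T b → Q) → T (a ∨ b) → P ⊎ Q
either f g = Sum.map f g ∘ Equivalence.to T-∨

inRange-sound : ∀ k is → T (inRange k is) → All (_< k) is
inRange-sound k is ok = All.map (λ {i} → <ᵇ⇒< i k) (all⁺ (_<ᵇ k) is ok)

vertices : ∀ {n} (s : List (Fin n)) → Unique s → ∀ is → T (distinctInRange (length s) is) →
           ∃ λ xs → Pointwise (At s) is xs × Unique xs
vertices s s-un is ok with ∧⁻ (inRange (length s) is) ok
... | in-range , is-distinct with entries s is (inRange-sound (length s) is in-range)
... | xs , at = xs , at , entries-unique s s-un (toWitness is-distinct) at

pair-sound : ∀ {n} (s : List (Fin n)) {e i j x y} → At s i x → At s j y →
             T (hasPair (signature s e) i j) → x , y ⊆ₑ e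
pair-sound s {e} {i} {j} p q ok with ∧⁻ (bit (signature s e) i) ok
... | bi , bj = bit-sound s i p bi , bit-sound s j q bj

triple-sound : ∀ {n} (s : List (Fin n)) {e i j l x y z} → ∣ e ∣ ≡ 3 → At s i x → At s j y → At s l z →
               x ≢ y → x ≢ z → y ≢ z → T (hasTriple (signature s e) i j l) → e ≡ triple x y z
triple-sound s {e} {i} {j} {l} e≡3 p q r x≢y x≢z y≢z ok with ∧⁻ (bit (signature s e) i) ok
... | bi , bjl with ∧⁻ (bit (signature s e) j) bjl
... | bj , bl = ≡triple e≡3 (bit-sound s i p bi) (bit-sound s j q bj) (bit-sound s l r bl) x≢y x≢z y≢z

module _ {n} (s : List (Fin n)) {e : Subset n} (e≡3 : ∣ e ∣ ≡ 3) where

  edgeH0-sound : ∀ {i₀ i₁ i₂ x₀ x₁ x₂} →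
    Pointwise (At s) (i₀ ∷ i₁ ∷ i₂ ∷ []) (x₀ ∷ x₁ ∷ x₂ ∷ []) →
    Unique (x₀ ∷ x₁ ∷ x₂ ∷ []) → T (isEdgeH0 i₀ i₁ i₂ (signature s e)) → EdgeH0 x₀ x₁ x₂ e
  edgeH0-sound (p₀ ∷ p₁ ∷ p₂ ∷ []) _ =
    either (pair-sound s p₀ p₁) (
    either (pair-sound s p₀ p₂) (
    pair-sound s p₁ p₂))

  edgeH1-sound : ∀ {i₀ i₁ i₂ i₃ x₀ x₁ x₂ x₃} →
    Pointwise (At s) (i₀ ∷ i₁ ∷ i₂ ∷ i₃ ∷ []) (x₀ ∷ x₁ ∷ x₂ ∷ x₃ ∷ []) →
    Unique (x₀ ∷ x₁ ∷ x₂ ∷ x₃ ∷ []) → T (isEdgeH1 i₀ i₁ i₂ i₃ (signature s e)) →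
    EdgeH1 x₀ x₁ x₂ x₃ e
  edgeH1-sound (p₀ ∷ p₁ ∷ p₂ ∷ p₃ ∷ [])
               ( (_ ∷ _ ∷ _ ∷ [])
               ∷ (d₁₂ ∷ d₁₃ ∷ [])
               ∷ (d₂₃ ∷ []) ∷ [] ∷ []) =
    either (pair-sound s p₀ p₁) (
    either (pair-sound s p₀ p₂) (
    either (pair-sound s p₀ p₃) (
    triple-sound s e≡3 p₁ p₂ p₃ d₁₂ d₁₃ d₂₃)))

  edgeH2-sound : ∀ {i₀ i₁ i₂ i₃ i₄ x₀ x₁ x₂ x₃ x₄} →
    Pointwise (At s) (i₀ ∷ i₁ ∷ i₂ ∷ i₃ ∷ i₄ ∷ []) (x₀ ∷ x₁ ∷ x₂ ∷ x₃ ∷ x₄ ∷ []) →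
    Unique (x₀ ∷ x₁ ∷ x₂ ∷ x₃ ∷ x₄ ∷ []) → T (isEdgeH2 i₀ i₁ i₂ i₃ i₄ (signature s e)) →
    EdgeH2 x₀ x₁ x₂ x₃ x₄ e
  edgeH2-sound (p₀ ∷ p₁ ∷ p₂ ∷ p₃ ∷ p₄ ∷ [])
               ( (_ ∷ _ ∷ d₀₃ ∷ d₀₄ ∷ [])
               ∷ (d₁₂ ∷ d₁₃ ∷ d₁₄ ∷ [])
               ∷ (d₂₃ ∷ d₂₄ ∷ [])
               ∷ (d₃₄ ∷ []) ∷ [] ∷ []) =
    either (pair-sound s p₀ p₁) (
    either (pair-sound s p₀ p₂) (
    either (triple-sound s e≡3 p₁ p₂ p₃ d₁₂ d₁₃ d₂₃) (
    either (triple-sound s e≡3 p₁ p₂ p₄ d₁₂ d₁₄ d₂₄) (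
    triple-sound s e≡3 p₀ p₃ p₄ d₀₃ d₀₄ d₃₄))))

  edgeH3-sound : ∀ {i₀ i₁ i₂ i₃ i₄ x₀ x₁ x₂ x₃ x₄} →
    Pointwise (At s) (i₀ ∷ i₁ ∷ i₂ ∷ i₃ ∷ i₄ ∷ []) (x₀ ∷ x₁ ∷ x₂ ∷ x₃ ∷ x₄ ∷ []) →
    Unique (x₀ ∷ x₁ ∷ x₂ ∷ x₃ ∷ x₄ ∷ []) → T (isEdgeH3 i₀ i₁ i₂ i₃ i₄ (signature s e)) →
    EdgeH3 x₀ x₁ x₂ x₃ x₄ e
  edgeH3-sound (p₀ ∷ p₁ ∷ p₂ ∷ p₃ ∷ p₄ ∷ [])
               ( (_ ∷ d₀₂ ∷ d₀₃ ∷ d₀₄ ∷ [])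
               ∷ (d₁₂ ∷ d₁₃ ∷ d₁₄ ∷ [])
               ∷ (d₂₃ ∷ d₂₄ ∷ [])
               ∷ (d₃₄ ∷ []) ∷ [] ∷ []) =
    either (pair-sound s p₀ p₁) (
    either (triple-sound s e≡3 p₀ p₂ p₃ d₀₂ d₀₃ d₂₃) (
    either (triple-sound s e≡3 p₀ p₂ p₄ d₀₂ d₀₄ d₂₄) (
    either (triple-sound s e≡3 p₀ p₃ p₄ d₀₃ d₀₄ d₃₄) (
    either (triple-sound s e≡3 p₁ p₂ p₃ d₁₂ d₁₃ d₂₃) (
    either (triple-sound s e≡3 p₁ p₂ p₄ d₁₂ d₁₄ d₂₄) (
    triple-sound s e≡3 p₁ p₃ p₄ d₁₃ d₁₄ d₃₄))))))

  edgeH4-sound : ∀ {i₀ i₁ i₂ i₃ i₄ i₅ x₀ x₁ x₂ x₃ x₄ x₅} →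
    Pointwise (At s) (i₀ ∷ i₁ ∷ i₂ ∷ i₃ ∷ i₄ ∷ i₅ ∷ []) (x₀ ∷ x₁ ∷ x₂ ∷ x₃ ∷ x₄ ∷ x₅ ∷ []) →
    Unique (x₀ ∷ x₁ ∷ x₂ ∷ x₃ ∷ x₄ ∷ x₅ ∷ []) → T (isEdgeH4 i₀ i₁ i₂ i₃ i₄ i₅ (signature s e)) →
    EdgeH4 x₀ x₁ x₂ x₃ x₄ x₅ e
  edgeH4-sound (p₀ ∷ p₁ ∷ p₂ ∷ p₃ ∷ p₄ ∷ p₅ ∷ [])
               ( (_ ∷ d₀₂ ∷ d₀₃ ∷ d₀₄ ∷ d₀₅ ∷ [])
               ∷ (d₁₂ ∷ d₁₃ ∷ d₁₄ ∷ d₁₅ ∷ [])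
               ∷ (d₂₃ ∷ d₂₄ ∷ d₂₅ ∷ [])
               ∷ (d₃₄ ∷ d₃₅ ∷ [])
               ∷ (d₄₅ ∷ []) ∷ [] ∷ []) =
    either (pair-sound s p₀ p₁) (
    either (triple-sound s e≡3 p₀ p₂ p₃ d₀₂ d₀₃ d₂₃) (
    either (triple-sound s e≡3 p₀ p₄ p₅ d₀₄ d₀₅ d₄₅) (
    either (triple-sound s e≡3 p₁ p₂ p₄ d₁₂ d₁₄ d₂₄) (
    either (triple-sound s e≡3 p₁ p₂ p₅ d₁₂ d₁₅ d₂₅) (
    either (triple-sound s e≡3 p₁ p₃ p₄ d₁₃ d₁₄ d₃₄) (
    triple-sound s e≡3 p₁ p₃ p₅ d₁₃ d₁₅ d₃₅))))))

  edgeH5-sound : ∀ {i₀ i₁ i₂ i₃ i₄ i₅ x₀ x₁ x₂ x₃ x₄ x₅} →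
    Pointwise (At s) (i₀ ∷ i₁ ∷ i₂ ∷ i₃ ∷ i₄ ∷ i₅ ∷ []) (x₀ ∷ x₁ ∷ x₂ ∷ x₃ ∷ x₄ ∷ x₅ ∷ []) →
    Unique (x₀ ∷ x₁ ∷ x₂ ∷ x₃ ∷ x₄ ∷ x₅ ∷ []) → T (isEdgeH5 i₀ i₁ i₂ i₃ i₄ i₅ (signature s e)) →
    EdgeH5 x₀ x₁ x₂ x₃ x₄ x₅ e
  edgeH5-sound (p₀ ∷ p₁ ∷ p₂ ∷ p₃ ∷ p₄ ∷ p₅ ∷ [])
               ( (_ ∷ d₀₂ ∷ d₀₃ ∷ d₀₄ ∷ d₀₅ ∷ [])
               ∷ (d₁₂ ∷ d₁₃ ∷ d₁₄ ∷ d₁₅ ∷ [])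
               ∷ (d₂₃ ∷ d₂₄ ∷ d₂₅ ∷ [])
               ∷ (_ ∷ d₃₅ ∷ [])
               ∷ (d₄₅ ∷ []) ∷ [] ∷ []) =
    either (pair-sound s p₀ p₁) (
    either (triple-sound s e≡3 p₀ p₂ p₃ d₀₂ d₀₃ d₂₃) (
    either (triple-sound s e≡3 p₀ p₄ p₅ d₀₄ d₀₅ d₄₅) (
    either (triple-sound s e≡3 p₀ p₂ p₅ d₀₂ d₀₅ d₂₅) (
    either (triple-sound s e≡3 p₁ p₂ p₅ d₁₂ d₁₅ d₂₅) (
    either (triple-sound s e≡3 p₁ p₂ p₄ d₁₂ d₁₄ d₂₄) (
    triple-sound s e≡3 p₁ p₃ p₅ d₁₃ d₁₅ d₃₅))))))

module Soundness {n} (H : ThreeGraph n) (intersecting : Intersecting H) (6≤n : 6 ≤ n) where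

  edge-size : ∀ {e} → e ∈ₗ edges H → ∣ e ∣ ≡ 3
  edge-size = All.lookup (uniform H)

  -- The invariant of the exploration: the explored vertices are distinct and
  -- every edge has one of the candidate signatures.
  record Consistent (s : List (Fin n)) (A : List Signature) : Set where
    field
      unique-vertices : Unique s
      listed          : All (λ e → signature s e ∈ₗ A) (edges H)
  open Consistent

  ones≤3 : ∀ s {e} → Unique s → e ∈ₗ edges H → ones (signature s e) ≤ 3
  ones≤3 s {e} s-un e∈H = subst (ones (signature s e) ≤_) (edge-size e∈H) (ones-bound e s s-un)

  consistent-without : ∀ {s A σ} → Consistent s A → (∀ {e} → e ∈ₗ edges H → signature s e ≢ σ) →
                       Consistent s (without σ A)
  consistent-without {σ = σ} cons absent = record
    { unique-vertices = unique-vertices cons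
    ; listed          = All.tabulate λ e∈H →
        ∈-filter⁺ (λ τ → ¬? (σ ≟ˢ τ)) (All.lookup (listed cons) e∈H) (absent e∈H ∘ sym)
    }

  consistent-extend : ∀ {s A x} → Consistent s A → x ∉ₗ s → Consistent (x ∷ s) (extend A)
  consistent-extend {s} {A} {x} cons x∉s =
    record { unique-vertices = xs-distinct ; listed = All.tabulate extended }
    where
    xs-distinct : Unique (x ∷ s)
    xs-distinct = ¬Any⇒All¬ s x∉s ∷ unique-vertices cons
    extended : ∀ {e} → e ∈ₗ edges H → signature (x ∷ s) e ∈ₗ extend A
    extended e∈H = ∈-extend A (All.lookup (listed cons) e∈H) (ones≤3 (x ∷ s) xs-distinct e∈H)

  -- Once an edge e is fully explored, every edge meets it on an explored vertex,
  -- so only candidates meeting its signature remain.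
  consistent-meeting : ∀ {s A e} → Consistent s A → e ∈ₗ edges H → 3 ≤ ones (signature s e) →
                       Consistent s (meeting (signature s e) A)
  consistent-meeting {s} {A} {e} cons e∈H e-full = record
    { unique-vertices = unique-vertices cons ; listed = All.tabulate survives }
    where
    survives : ∀ {f} → f ∈ₗ edges H → signature s f ∈ₗ meeting (signature s e) A
    survives {f} f∈H with intersecting e∈H f∈H
    ... | x , x∈e∩f with x∈p∩q⁻ e f x∈e∩f
    ... | x∈e , x∈f =
      ∈-filter⁺ (T? ∘ meets (signature s e)) (All.lookup (listed cons) f∈H)
        (meets-complete s x∈s x∈e x∈f)
      where
      x∈s : x ∈ₗ s
      x∈s = fully-explored e s (unique-vertices cons)
              (subst (_≤ ones (signature s e)) (sym (edge-size e∈H)) e-full) x∈e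

  consistent-cover : ∀ {C} → Cover H C → let s = Enumeration.members (enumerate C) in
                     Consistent s (coverCandidates (length s))
  consistent-cover {C} cover = record { unique-vertices = distinct ; listed = All.tabulate candidate }
    where
    open Enumeration (enumerate C)
    candidate : ∀ {e} → e ∈ₗ edges H → signature members e ∈ₗ coverCandidates (length members)
    candidate {e} e∈H with All.lookup cover e∈H
    ... | x , x∈e∩C with x∈p∩q⁻ e C x∈e∩C
    ... | x∈e , x∈C =
      ∈-filter⁺ (T? ∘ _) (subst (λ k → signature members e ∈ₗ allSignatures k) (length-map _ members)
                                (∈-allSignatures (signature members e)))
        (Equivalence.from T-∧ (≤⇒≤ᵇ (ones-positive members (complete x∈C) x∈e) ,
                               ≤⇒≤ᵇ (ones≤3 members distinct e∈H)))

  consistent-start : Consistent [] ([] ∷ [])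
  consistent-start = record { unique-vertices = [] ; listed = All.tabulate (λ _ → here refl) }

  Outcome : Bool → Set
  Outcome false = InSomeH0to5 H
  Outcome true  = InSomeH0to5 H ⊎ τ≤ H 2 ⊎ size H ≤ 10

  found : ∀ exits → InSomeH0to5 H → Outcome exits
  found false h = h
  found true  h = inj₁ h

  every-edge : ∀ {s A} {p : Signature → Bool} {P : Subset n → Set} → Consistent s A → T (all p A) →
               (∀ {e} → ∣ e ∣ ≡ 3 → T (p (signature s e)) → P e) → All P (edges H)
  every-edge {s} {A} {p} cons all-p decode =
    All.tabulate λ e∈H → decode (edge-size e∈H) (All.lookup (all⁺ p A all-p) (All.lookup (listed cons) e∈H))

  -- If all candidates are fully explored, edges are determined by their
  -- signatures, so there are at most as many edges as candidates.
  edges≤candidates : ∀ {s A} → Consistent s A → T (all (λ σ → ones σ ≡ᵇ 3) A) → size H ≤ length A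
  edges≤candidates {s} {A} cons all-full =
    subst (_≤ length A) (length-map (signature s) (edges H))
      (unique-length-≤ (map (signature s) (edges H)) A
        (map-unique (signature s) (edges H) (unique H) same-edge)
        (map⁺ (listed cons)))
    where
    explored-all : ∀ {e} → e ∈ₗ edges H → ∀ {x} → x ∈ e → x ∈ₗ s
    explored-all {e} e∈H = fully-explored e s (unique-vertices cons)
      (≤-reflexive (trans (edge-size e∈H) (sym (≡ᵇ⇒≡ _ 3
        (All.lookup (all⁺ _ A all-full) (All.lookup (listed cons) e∈H))))))
    same-edge : ∀ {e f} → e ∈ₗ edges H → f ∈ₗ edges H → signature s e ≡ signature s f → e ≡ f
    same-edge e∈H f∈H same =
      ⊆-antisym (λ x∈e → signature-agree s (explored-all e∈H x∈e) same x∈e)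
                (λ x∈f → signature-agree s (explored-all f∈H x∈f) (sym same) x∈f)

  two-cover : ∀ {s A} i j → Consistent s A → T (inRange (length s) (i ∷ j ∷ [])) →
              T (all (λ σ → bit σ i ∨ bit σ j) A) → τ≤ H 2
  two-cover {s} i j cons in-range all-ij with entries s (i ∷ j ∷ []) (inRange-sound _ _ in-range)
  ... | x ∷ y ∷ [] , p ∷ q ∷ [] =
    ⁅ x ⁆ ∪ ⁅ y ⁆ , every-edge cons all-ij hit ,
    subst (∣ ⁅ x ⁆ ∪ ⁅ y ⁆ ∣ ≤_) (cong₂ _+_ (∣⁅x⁆∣≡1 x) (∣⁅x⁆∣≡1 y)) (∣p∪q∣≤∣p∣+∣q∣ ⁅ x ⁆ ⁅ y ⁆)
    where
    hit : ∀ {e} → ∣ e ∣ ≡ 3 → T (bit (signature s e) i ∨ bit (signature s e) j) → Nonempty (e ∩ (⁅ x ⁆ ∪ ⁅ y ⁆))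
    hit _ = Sum.[ (λ x∈e → x , x∈p∩q⁺ (x∈e , x∈p∪q⁺ (inj₁ (x∈⁅x⁆ x))))
                , (λ y∈e → y , x∈p∩q⁺ (y∈e , x∈p∪q⁺ (inj₂ (x∈⁅x⁆ y)))) ]
              ∘ either (bit-sound s i p) (bit-sound s j q)

  sound-placement : ∀ {s A} → Consistent s A → ∀ l → T (checkPlacement (length s) A l) → InSomeH0to5 H
  sound-placement {s} {A} cons (inH i) ok with ∧⁻ (inRange (length s) (i ∷ [])) ok
  ... | in-range , all-i with entries s (i ∷ []) (inRange-sound _ _ in-range)
  ... | x ∷ [] , p ∷ [] = inj₁ (inj₁ (x , every-edge cons all-i λ _ → bit-sound s i p))
  sound-placement {s} {A} cons (inH0 i₀ i₁ i₂) ok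
    with ∧⁻ (distinctInRange (length s) (i₀ ∷ i₁ ∷ i₂ ∷ [])) ok
  ... | valid , all-H0 with vertices s (unique-vertices cons) (i₀ ∷ i₁ ∷ i₂ ∷ []) valid
  ... | x₀ ∷ x₁ ∷ x₂ ∷ [] , at@(_ ∷ _ ∷ _ ∷ []) , u =
    inj₁ (inj₂ (inj₁ (x₀ , x₁ , x₂ , u , every-edge cons all-H0 λ e≡3 → edgeH0-sound s e≡3 at u)))
  sound-placement {s} {A} cons (inH1 i₀ i₁ i₂ i₃) ok
    with ∧⁻ (distinctInRange (length s) (i₀ ∷ i₁ ∷ i₂ ∷ i₃ ∷ [])) ok
  ... | valid , all-H1 with vertices s (unique-vertices cons) (i₀ ∷ i₁ ∷ i₂ ∷ i₃ ∷ []) valid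
  ... | x₀ ∷ x₁ ∷ x₂ ∷ x₃ ∷ [] , at@(_ ∷ _ ∷ _ ∷ _ ∷ []) , u =
    inj₁ (inj₂ (inj₂ (inj₁ (x₀ , x₁ , x₂ , x₃ , u , every-edge cons all-H1 λ e≡3 → edgeH1-sound s e≡3 at u))))
  sound-placement {s} {A} cons (inH2 i₀ i₁ i₂ i₃ i₄) ok
    with ∧⁻ (distinctInRange (length s) (i₀ ∷ i₁ ∷ i₂ ∷ i₃ ∷ i₄ ∷ [])) ok
  ... | valid , all-H2 with vertices s (unique-vertices cons) (i₀ ∷ i₁ ∷ i₂ ∷ i₃ ∷ i₄ ∷ []) valid
  ... | x₀ ∷ x₁ ∷ x₂ ∷ x₃ ∷ x₄ ∷ [] , at@(_ ∷ _ ∷ _ ∷ _ ∷ _ ∷ []) , u =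
    inj₁ (inj₂ (inj₂ (inj₂ (x₀ , x₁ , x₂ , x₃ , x₄ , u , every-edge cons all-H2 λ e≡3 → edgeH2-sound s e≡3 at u))))
  sound-placement {s} {A} cons (inH3 i₀ i₁ i₂ i₃ i₄) ok
    with ∧⁻ (distinctInRange (length s) (i₀ ∷ i₁ ∷ i₂ ∷ i₃ ∷ i₄ ∷ [])) ok
  ... | valid , all-H3 with vertices s (unique-vertices cons) (i₀ ∷ i₁ ∷ i₂ ∷ i₃ ∷ i₄ ∷ []) valid
  ... | x₀ ∷ x₁ ∷ x₂ ∷ x₃ ∷ x₄ ∷ [] , at@(_ ∷ _ ∷ _ ∷ _ ∷ _ ∷ []) , u =
    inj₂ (inj₁ (x₀ , x₁ , x₂ , x₃ , x₄ , u , every-edge cons all-H3 λ e≡3 → edgeH3-sound s e≡3 at u))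
  sound-placement {s} {A} cons (inH4 i₀ i₁ i₂ i₃ i₄ i₅) ok
    with ∧⁻ (distinctInRange (length s) (i₀ ∷ i₁ ∷ i₂ ∷ i₃ ∷ i₄ ∷ i₅ ∷ [])) ok
  ... | valid , all-H4 with vertices s (unique-vertices cons) (i₀ ∷ i₁ ∷ i₂ ∷ i₃ ∷ i₄ ∷ i₅ ∷ []) valid
  ... | x₀ ∷ x₁ ∷ x₂ ∷ x₃ ∷ x₄ ∷ x₅ ∷ [] , at@(_ ∷ _ ∷ _ ∷ _ ∷ _ ∷ _ ∷ []) , u =
    inj₂ (inj₂ (inj₁ (x₀ , x₁ , x₂ , x₃ , x₄ , x₅ , u , every-edge cons all-H4 λ e≡3 → edgeH4-sound s e≡3 at u)))
  sound-placement {s} {A} cons (inH5 i₀ i₁ i₂ i₃ i₄ i₅) ok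
    with ∧⁻ (distinctInRange (length s) (i₀ ∷ i₁ ∷ i₂ ∷ i₃ ∷ i₄ ∷ i₅ ∷ [])) ok
  ... | valid , all-H5 with vertices s (unique-vertices cons) (i₀ ∷ i₁ ∷ i₂ ∷ i₃ ∷ i₄ ∷ i₅ ∷ []) valid
  ... | x₀ ∷ x₁ ∷ x₂ ∷ x₃ ∷ x₄ ∷ x₅ ∷ [] , at@(_ ∷ _ ∷ _ ∷ _ ∷ _ ∷ _ ∷ []) , u =
    inj₂ (inj₂ (inj₂ (x₀ , x₁ , x₂ , x₃ , x₄ , x₅ , u , every-edge cons all-H5 λ e≡3 → edgeH5-sound s e≡3 at u)))

  mutual
    sound : ∀ exits c s A → Consistent s A → T (check exits (length s) A c) → Outcome exits
    sound exits (split i c₁ c₂) s A cons ok = sound-split exits (position A i) c₁ c₂ s A cons ok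
    sound exits (fresh c) s A cons ok with ∧⁻ (length s <ᵇ 6) ok
    ... | room , ok′ with unlisted s (<-≤-trans (<ᵇ⇒< (length s) 6 room) 6≤n)
    ... | x , x∉s = sound exits c (x ∷ s) (extend A) (consistent-extend cons x∉s) ok′
    sound exits (placed l) s A cons ok = found exits (sound-placement cons l ok)
    sound true leafSmall s A cons ok with ∧⁻ (all (λ σ → ones σ ≡ᵇ 3) A) ok
    ... | all-full , few = inj₂ (inj₂ (≤-trans (edges≤candidates cons all-full) (≤ᵇ⇒≤ _ 10 few)))
    sound true (leafCover i j) s A cons ok with ∧⁻ (inRange (length s) (i ∷ j ∷ [])) ok
    ... | in-range , all-ij = inj₂ (inj₁ (two-cover i j cons in-range all-ij))

    sound-split : ∀ exits σ? c₁ c₂ s A → Consistent s A → T (checkSplit exits (length s) A σ? c₁ c₂) →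
                  Outcome exits
    sound-split exits (just σ) c₁ c₂ s A cons ok
      with ∧⁻ (check exits (length s) (without σ A) c₁) ok | any? (λ e → signature s e ≟ˢ σ) (edges H)
    ... | _ , ok-present | yes some-edge with find some-edge
    ... | e , e∈H , refl = sound-present exits 3 c₂ s A cons e∈H ok-present
    sound-split exits (just σ) c₁ c₂ s A cons ok | ok-absent , _ | no no-edge =
      sound exits c₁ s (without σ A) (consistent-without cons λ e∈H same → no-edge (lose e∈H same)) ok-absent

    sound-present : ∀ exits fuel c s A {e} → Consistent s A → e ∈ₗ edges H →
                    T (checkPresent exits fuel (length s) A (signature s e) c) → Outcome exits
    sound-present exits zero c s A {e} cons e∈H ok with ∧⁻ (full (signature s e)) ok
    ... | e-full , ok′ = sound exits c s _ (consistent-meeting cons e∈H (≤ᵇ⇒≤ 3 _ e-full)) ok′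
    sound-present exits (suc fuel) c s A {e} cons e∈H ok with full (signature s e) in e-full
    ... | true = sound exits c s _ (consistent-meeting cons e∈H (≤ᵇ⇒≤ 3 _ (subst T (sym e-full) tt))) ok
    ... | false with unexplored-member e s (subst (ones (signature s e) <_) (sym (edge-size e∈H))
                       (≰⇒> λ e-full′ → subst T e-full (≤⇒≤ᵇ e-full′)))
    ... | x , x∈e , x∉s =
      sound-present exits fuel c (x ∷ s) (extend A) (consistent-extend cons x∉s) e∈H
        (subst (λ σ → T (checkPresent exits fuel (suc (length s)) (extend A) σ c)) (sym (signature-member s x∈e)) ok)

pair-star-bound : ∀ {n} (H : ThreeGraph n) {v₁ v₂ : Fin n} → v₁ ≢ v₂ → (extra : List (Subset n)) →
                  All (λ e → (v₁ , v₂ ⊆ₑ e) ⊎ e ∈ₗ extra) (edges H) → 2 + size H ≤ length extra + n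
pair-star-bound {n} H {v₁} {v₂} v₁≢v₂ extra pair-or-extra =
  subst (2 + size H ≤_) count (s≤s (s≤s (unique-length-≤ (edges H) candidates (unique H) (All.tabulate listed))))
  where
  v₁∈all : v₁ ∈ₗ allFin n
  v₁∈all = ∈-allFin v₁
  v₂∈rest : v₂ ∈ₗ remove (allFin n) v₁∈all
  v₂∈rest = ∈-remove (allFin n) v₁∈all (∈-allFin v₂) (v₁≢v₂ ∘ sym)
  others : List (Fin n)
  others = remove (remove (allFin n) v₁∈all) v₂∈rest
  others-size : 2 + length others ≡ n
  others-size = trans (cong suc (length-remove _ v₂∈rest))
                      (trans (length-remove (allFin n) v₁∈all) (length-tabulate (λ x → x)))
  candidates : List (Subset n)
  candidates = extra ++ map (triple v₁ v₂) others
  count : 2 + length candidates ≡ length extra + n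
  count = begin
    2 + length candidates                      ≡⟨ cong (2 +_) (length-++ extra) ⟩
    2 + (length extra + length (map _ others)) ≡⟨ cong (λ m → 2 + (length extra + m)) (length-map _ others) ⟩
    2 + (length extra + length others)         ≡⟨ sym (trans (+-suc (length extra) _) (cong suc (+-suc _ _))) ⟩
    length extra + (2 + length others)         ≡⟨ cong (length extra +_) others-size ⟩
    length extra + n                           ∎
    where open ≡-Reasoning
  listed : ∀ {e} → e ∈ₗ edges H → e ∈ₗ candidates
  listed {e} e∈H with All.lookup pair-or-extra e∈H
  ... | inj₂ e∈extra = ∈-++⁺ˡ e∈extra
  ... | inj₁ (v₁∈e , v₂∈e)
    with member-outside e (v₁ ∷ v₂ ∷ []) (subst (2 <_) (sym (All.lookup (uniform H) e∈H)) (s≤s (s≤s (s≤s z≤n))))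
  ... | w , w∈e , w∉v₁v₂ =
    subst (_∈ₗ candidates) (sym (≡triple (All.lookup (uniform H) e∈H) v₁∈e v₂∈e w∈e v₁≢v₂ (w≢v₁ ∘ sym) (w≢v₂ ∘ sym)))
      (∈-++⁺ʳ extra (∈-map⁺ (triple v₁ v₂) (∈-remove _ v₂∈rest (∈-remove (allFin n) v₁∈all (∈-allFin w) w≢v₁) w≢v₂)))
    where
    w≢v₁ : w ≢ v₁
    w≢v₁ w≡v₁ = w∉v₁v₂ (here w≡v₁)
    w≢v₂ : w ≢ v₂
    w≢v₂ w≡v₂ = w∉v₁v₂ (there (here w≡v₂))

pair-or-six : ∀ {n} {P : Set} {e t₁ t₂ t₃ t₄ t₅ t₆ : Subset n} →
              P ⊎ e ≡ t₁ ⊎ e ≡ t₂ ⊎ e ≡ t₃ ⊎ e ≡ t₄ ⊎ e ≡ t₅ ⊎ e ≡ t₆ →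
              P ⊎ e ∈ₗ t₁ ∷ t₂ ∷ t₃ ∷ t₄ ∷ t₅ ∷ t₆ ∷ []
pair-or-six (inj₁ p)                                   = inj₁ p
pair-or-six (inj₂ (inj₁ e≡t))                          = inj₂ (here e≡t)
pair-or-six (inj₂ (inj₂ (inj₁ e≡t)))                   = inj₂ (there (here e≡t))
pair-or-six (inj₂ (inj₂ (inj₂ (inj₁ e≡t))))            = inj₂ (there (there (here e≡t)))
pair-or-six (inj₂ (inj₂ (inj₂ (inj₂ (inj₁ e≡t)))))     = inj₂ (there (there (there (here e≡t))))
pair-or-six (inj₂ (inj₂ (inj₂ (inj₂ (inj₂ (inj₁ e≡t)))))) = inj₂ (there (there (there (there (here e≡t)))))
pair-or-six (inj₂ (inj₂ (inj₂ (inj₂ (inj₂ (inj₂ e≡t)))))) = inj₂ (there (there (there (there (there (here e≡t))))))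

few-edges : ∀ {n} (H : ThreeGraph n) → InH3 H ⊎ InH4 H ⊎ InH5 H → size H ≤ n + 4
few-edges {n} H in-H3-to-H5 = subst (size H ≤_) (+-comm 4 n) (≤-pred (≤-pred (bound in-H3-to-H5)))
  where
  bound : InH3 H ⊎ InH4 H ⊎ InH5 H → 2 + size H ≤ 6 + n
  bound (inj₁ (_ , _ , _ , _ , _ , (v₁≢v₂ ∷ _) ∷ _ , in-H3)) =
    pair-star-bound H v₁≢v₂ _ (All.map pair-or-six in-H3)
  bound (inj₂ (inj₁ (_ , _ , _ , _ , _ , _ , (v₁≢v₂ ∷ _) ∷ _ , in-H4))) =
    pair-star-bound H v₁≢v₂ _ (All.map pair-or-six in-H4)
  bound (inj₂ (inj₂ (_ , _ , _ , _ , _ , _ , (v₁≢v₂ ∷ _) ∷ _ , in-H5))) =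
    pair-star-bound H v₁≢v₂ _ (All.map pair-or-six in-H5)

-- The certificates, found by computer search.  The first three start from a
-- cover of size 0, 1 and 2; the last one starts from no explored vertex.

coverCertificate₀ : Certificate
coverCertificate₀ =
  fresh (placed (inH 0))

coverCertificate₁ : Certificate
coverCertificate₁ =
  placed (inH 0)

coverCertificate₂ : Certificate
coverCertificate₂ =
  split 0 (placed (inH 0)) (split 6 (split 5 (split 4 (placed (inH 3)) (split 5
  (placed (inH1 4 0 1 3)) (split 0 (placed (inH0 2 4 5)) (placed (inH2 5 2 4 0 1))))) (split 6
  (split 6 (split 5 (placed (inH1 4 0 2 3)) (split 4 (placed (inH4 4 5 0 2 1 3))
  (placed (inH2 5 3 6 2 4)))) (split 0 (split 5 (split 4 (placed (inH0 3 4 5)) (split 0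
  (placed (inH1 5 3 4 6)) (placed (inH2 5 4 6 0 3)))) (split 0 (placed (inH1 4 2 3 5))
  (placed (inH2 4 3 5 0 2)))) (split 5 (placed (inH2 5 3 4 0 1)) (placed (inH5 4 5 0 2 1 3)))))
  (split 6 (split 4 (placed (inH2 4 0 3 1 2)) (split 0 (placed (inH2 4 2 5 1 3))
  (placed (inH5 4 5 1 3 0 2)))) (split 1 (split 0 (placed (inH1 4 2 3 5))
  (placed (inH4 5 4 0 1 2 3))) (split 0 (placed (inH2 4 3 5 1 2))
  (placed (inH5 4 5 1 2 0 3))))))) (split 1 (split 3 (placed (inH0 0 2 3)) (split 0
  (placed (inH1 3 1 2 4)) (placed (inH2 3 1 4 0 2)))) (split 5 (split 1 (split 0
  (placed (inH0 2 3 4)) (split 6 (placed (inH1 5 2 3 4)) (placed (inH2 5 3 4 0 2)))) (split 5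
  (placed (inH1 4 1 2 3)) (placed (inH2 4 2 3 0 1)))) (split 1 (split 0 (placed (inH2 3 2 4 0 1))
  (split 5 (placed (inH2 5 2 4 1 3)) (placed (inH5 4 5 2 1 0 3)))) (split 5
  (placed (inH2 4 1 3 0 2)) (placed (inH3 3 4 0 1 2)))))))

largeCertificate : Certificate
largeCertificate =
  split 0 leafSmall (split 3 (leafCover 0 1) (split 8 (split 4 (split 1 (split 6 (split 2 (split
  7 (split 4 (leafCover 0 4) (split 0 (split 8 (split 4 leafSmall (leafCover 2 5))
  (leafCover 4 5)) (split 0 (split 3 (split 1 leafSmall leafSmall) (split 1 leafSmall
  (leafCover 1 3))) (leafCover 2 4)))) (leafCover 3 5)) (split 7 (leafCover 1 5) (split 3 (split
  11 (split 0 (split 12 (split 1 (split 3 (split 2 leafSmall leafSmall) (split 2 leafSmall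
  (leafCover 1 4))) (split 4 (split 3 leafSmall leafSmall) (leafCover 1 3))) (split 9 (split 3
  (split 2 leafSmall leafSmall) (split 2 leafSmall (leafCover 1 4))) (leafCover 4 5)))
  (leafCover 2 4)) (split 0 (leafCover 5 6) (split 2 leafSmall (leafCover 2 5))))
  (leafCover 2 5)))) (leafCover 1 5)) (split 13 (split 2 (split 9 (split 0 (split 12 (split 4
  (split 3 (leafCover 3 5) (split 12 (split 4 (split 4 (split 2 (leafCover 0 5) leafSmall) (split
  2 leafSmall leafSmall)) (split 2 (split 4 leafSmall leafSmall) (leafCover 1 3))) (split 4
  (split 3 (split 1 (leafCover 0 5) leafSmall) (split 1 leafSmall leafSmall)) (split 3 (split 1
  leafSmall leafSmall) (split 1 leafSmall leafSmall))))) (split 12 (split 5 (split 5 (split 2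
  leafSmall leafSmall) (split 2 leafSmall leafSmall)) (split 2 (split 5 leafSmall leafSmall)
  (leafCover 1 3))) (split 5 (split 4 (split 1 leafSmall leafSmall) (split 1 leafSmall
  leafSmall)) (split 4 (split 1 leafSmall leafSmall) (split 1 leafSmall leafSmall))))) (split 9
  (split 3 (leafCover 3 5) (split 12 (split 4 (split 4 (split 2 leafSmall leafSmall) (split 2
  leafSmall (leafCover 2 3))) (split 2 (split 4 leafSmall leafSmall) (leafCover 1 3))) (split 6
  (split 4 (split 1 leafSmall leafSmall) (split 1 leafSmall (leafCover 2 3))) (leafCover 2 5))))
  (leafCover 3 5))) (leafCover 2 4)) (split 6 (split 13 (split 3 (leafCover 4 6) (split 0
  (leafCover 3 6) (split 4 leafSmall (leafCover 3 4)))) (leafCover 3 6)) (leafCover 4 7)))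
  (leafCover 3 4)) (leafCover 4 6))) (split 6 (split 1 (split 15 (split 10 (split 3 (split 15
  (split 12 (split 7 (split 12 (split 6 (split 5 (split 2 (leafCover 0 5) leafSmall) (split 2
  leafSmall leafSmall)) (split 5 (split 2 leafSmall leafSmall) (split 2 leafSmall leafSmall)))
  (split 5 (split 4 (split 1 (leafCover 0 5) leafSmall) (split 1 leafSmall leafSmall)) (split 4
  (split 1 leafSmall leafSmall) (leafCover 1 4)))) (split 5 (split 9 (split 10 (split 5 leafSmall
  leafSmall) (split 4 leafSmall (leafCover 1 4))) (split 11 (split 5 (split 2 leafSmall
  leafSmall) (split 2 leafSmall leafSmall)) (split 4 (split 1 leafSmall leafSmall) (split 1
  leafSmall leafSmall)))) (split 0 (leafCover 2 4) (split 11 (split 6 (split 2 leafSmall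
  leafSmall) (split 2 leafSmall leafSmall)) (split 5 (split 1 leafSmall leafSmall)
  (leafCover 1 4)))))) (split 5 (split 0 (leafCover 2 5) (split 5 (split 4 (split 2
  (leafCover 0 5) (split 9 leafSmall leafSmall)) (split 10 (split 2 leafSmall leafSmall) (split 1
  leafSmall leafSmall))) (split 11 (split 2 (split 3 leafSmall leafSmall) (leafCover 2 3)) (split
  3 (split 1 leafSmall leafSmall) (split 1 leafSmall leafSmall))))) (split 6 (split 11 (split 4
  (split 2 leafSmall leafSmall) (split 2 leafSmall leafSmall)) (split 3 (split 1 leafSmall
  leafSmall) (split 1 leafSmall leafSmall))) (split 11 (split 2 (split 3 leafSmall leafSmall)
  (leafCover 2 3)) (split 3 (split 1 leafSmall leafSmall) (split 1 leafSmall leafSmall))))))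
  (split 11 (split 6 (split 11 (split 5 (split 4 (split 1 (leafCover 0 5) leafSmall) (split 1
  leafSmall leafSmall)) (split 4 (split 1 leafSmall leafSmall) (split 1 leafSmall leafSmall)))
  (split 9 (split 4 (split 3 leafSmall leafSmall) (split 3 leafSmall (leafCover 1 4)))
  (leafCover 4 5))) (split 4 (split 8 (leafCover 2 4) (split 10 (split 4 (split 1 leafSmall
  leafSmall) (split 1 leafSmall leafSmall)) (split 0 (leafCover 4 5) (split 3 leafSmall
  leafSmall)))) (leafCover 2 4))) (split 7 (split 4 (leafCover 2 5) (split 5 (split 10 (split 3
  (split 1 leafSmall leafSmall) (split 1 leafSmall leafSmall)) (split 0 (leafCover 4 5) (split 2
  leafSmall leafSmall))) (split 3 (split 9 (split 1 leafSmall (leafCover 2 3)) (split 0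
  (leafCover 4 5) leafSmall)) (leafCover 2 4)))) (leafCover 2 5)))) (leafCover 2 5)) (split 7
  (split 11 (split 10 (split 5 (split 2 (leafCover 3 6) (split 0 (leafCover 5 6) leafSmall))
  (leafCover 3 5)) (leafCover 3 6)) (leafCover 3 6)) (leafCover 4 7))) (leafCover 5 6)) (split 10
  (split 1 (split 10 (split 2 (split 0 (split 4 (split 8 (leafCover 3 5) (split 3 (leafCover 3 6)
  (split 1 leafSmall (leafCover 3 4)))) (leafCover 3 5)) (split 3 (leafCover 3 4) leafSmall))
  (leafCover 3 4)) (split 0 (leafCover 3 6) (leafCover 3 4))) (leafCover 4 5)) (leafCover 4 7)))
  (leafCover 3 5))) (split 8 (split 23 (split 18 (split 14 (split 11 (split 9 (split 8 (split 21
  (split 17 (split 19 (split 18 (split 15 (split 12 (split 7 (split 3 (split 8 (split 4 (split 1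
  (leafCover 0 6) leafSmall) (split 8 leafSmall (leafCover 2 6))) (leafCover 2 6)) (split 4
  (split 4 (leafCover 4 6) leafSmall) leafSmall)) (split 0 (split 1 (split 6 leafSmall
  (leafCover 5 6)) leafSmall) leafSmall)) (split 8 (split 12 (split 3 (split 0 (leafCover 3 6)
  leafSmall) (split 4 leafSmall leafSmall)) (split 3 (leafCover 4 6) (leafCover 1 6)))
  (leafCover 1 6))) (split 12 (split 5 (split 4 (leafCover 4 6) (split 7 (split 2 (leafCover 2 6)
  leafSmall) (leafCover 1 6))) (split 3 (split 0 (leafCover 3 6) leafSmall) (leafCover 1 6)))
  (leafCover 4 6))) (split 13 (split 13 (split 13 (split 1 (split 0 (leafCover 5 6) (split 3
  (leafCover 2 6) leafSmall)) (split 0 (split 1 (leafCover 3 6) leafSmall) (leafCover 1 6)))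
  (leafCover 5 6)) (split 1 (leafCover 2 6) (leafCover 1 6))) (leafCover 1 6))) (split 14 (split
  13 (split 10 (split 5 (split 7 (split 1 (split 10 (split 2 (leafCover 0 6) leafSmall)
  (leafCover 5 6)) (leafCover 2 6)) (leafCover 2 6)) (split 0 (leafCover 5 6) leafSmall)) (split
  0 (leafCover 5 6) (leafCover 1 6))) (split 3 (leafCover 2 6) (leafCover 1 6)))
  (leafCover 2 6))) (split 14 (split 16 (split 5 (split 12 (split 7 (split 1 (split 7 (split 2
  (leafCover 0 6) leafSmall) (leafCover 3 6)) (leafCover 4 6)) (leafCover 4 6)) (leafCover 4 6))
  (split 0 (leafCover 3 6) (split 1 (leafCover 1 6) leafSmall))) (split 0 (leafCover 3 6)
  (leafCover 1 6))) (leafCover 4 6))) (split 15 (split 17 (split 13 (split 1 (split 14 (split 7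
  (split 2 (split 7 (split 3 (leafCover 0 6) leafSmall) (leafCover 3 6)) (leafCover 5 6))
  (leafCover 5 6)) (leafCover 5 6)) (split 2 (leafCover 3 6) (split 2 (leafCover 1 6)
  leafSmall))) (split 2 (leafCover 3 6) (leafCover 1 6))) (leafCover 5 6)) (leafCover 3 6)))
  (leafCover 1 7)) (leafCover 2 7)) (leafCover 3 7)) (leafCover 4 7)) (leafCover 5 7))
  (leafCover 6 7)) (leafCover 0 8))))

module Proof {n} (6≤n : 6 ≤ n) (H : ThreeGraph n) (intersecting : Intersecting H) where
  open Soundness H intersecting 6≤n

  from-cover : ∀ (s : List (Fin n)) → length s ≤ 2 → Consistent s (coverCandidates (length s)) →
               InSomeH0to5 H
  from-cover []              _                 cons = sound false coverCertificate₀ _ _ cons tt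
  from-cover (_ ∷ [])        _                 cons = sound false coverCertificate₁ _ _ cons tt
  from-cover (_ ∷ _ ∷ [])    _                 cons = sound false coverCertificate₂ _ _ cons tt
  from-cover (_ ∷ _ ∷ _ ∷ _) (s≤s (s≤s ())) _

  small-cover : τ≤ H 2 → InSomeH0to5 H
  small-cover (C , cover , C≤2) = from-cover members (subst (_≤ 2) (sym size≡) C≤2) (consistent-cover cover)
    where open Enumeration (enumerate C)

  many-edges : 11 ≤ size H → InSomeH0to5 H
  many-edges 11≤size with sound true largeCertificate [] _ consistent-start tt
  ... | inj₁ in-construction  = in-construction
  ... | inj₂ (inj₁ τ≤2)       = small-cover τ≤2
  ... | inj₂ (inj₂ size≤10)   = ⊥-elim (<⇒≱ 11≤size size≤10)

  -- Part (b): more than n + 4 ≥ 10 edges rule out H₃, H₄ and H₅.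
  more-than-n+4 : n + 4 < size H → InSomeH0to2 H
  more-than-n+4 n+4<size with many-edges (≤-trans (s≤s (+-monoˡ-≤ 4 6≤n)) n+4<size)
  ... | inj₁ in-H-to-H2  = in-H-to-H2
  ... | inj₂ in-H3-to-H5 = ⊥-elim (<⇒≱ n+4<size (few-edges H in-H3-to-H5))

theorem7 : (n : ℕ) → 6 ≤ n → (H : ThreeGraph n) → Intersecting H →
    (τ≤ H 2 → InSomeH0to5 H)
    × (11 ≤ size H → InSomeH0to5 H)
    × (n + 4 < size H → InSomeH0to2 H)
theorem7 n 6≤n H intersecting = small-cover , many-edges , more-than-n+4
  where open Proof 6≤n H intersecting
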